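{- Let $k \in \mathbb{Z}$ and $n,m,j\in\mathbb{Z}^+$ with $n\geq 2$, $k\not\equiv 0 \pmod n$, $m\geq 3$, and $1\leq j < \frac{m}{2}$, and let $G(m,j)$ be the generalized Petersen graph. Then: (1) if $(3,n)\mid k$, then $\chi_{(n,k)}(G(m,j)) = \chi(G(m,j))$; (2) if $(3,n) \nmid km$, then $\chi_{(n,k)}(G(m,j))$ does not exist; (3) if $(3,n)\nmid k$, $(3,n) \mid km$, and $3 \nmid j$, then $\chi_{(n,k)}(G(m,j))$ exists and $\chi(G(m,j)) \leq \chi_{(n,k)}(G(m,j)) \leq 2 \chi(G(m,j))$.
   Context: $G(m,j)$ has vertex set $\{v_i,u_i : 0\le i<m\}$ and edges $v_iv_{i+1}$, $v_iu_i$, $u_iu_{i+j}$ for $0\le i<m$, indices mod $m$. $(a,b)$ denotes the greatest common divisor. For a graph $G=(V,E)$, a $\mathbb{Z}$-labeling is a map $\ell:V\to\mathbb{Z}$; its order is the size of its range; it is proper if adjacent vertices get different labels; $\chi(G)$ is the minimum order of a proper labeling. $N(v)$ is the open neighborhood of $v$. An open coloring with remainder $k \bmod n$ is a labeling with $\sum_{w\in N(v)}\ell(w)\equiv k \pmod n$ for all $v\in V$. If no proper such coloring exists, $\chi_{(n,k)}(G)$ does not exist; otherwise it is the minimum order of a proper open coloring with remainder $k\bmod n$. -}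

module Defs where

open import Data.Nat as ℕ using (ℕ; zero; suc; _≤_; _<_)
open import Data.Nat.DivMod using (_%_; m%n<n)
open import Data.Fin as Fin using (Fin; fromℕ<; toℕ)
open import Data.Fin.Properties using () renaming (_≟_ to _≟ᶠ_)
open import Data.Integer as ℤ using (ℤ; +_)
open import Data.Integer.Properties using () renaming (_≟_ to _≟ℤ_)
open import Data.Integer.Divisibility using (_∣_)
open import Data.List using (List; _++_; map; allFin; length; deduplicate; foldr)
open import Data.Product using (Σ; _×_; _,_; ∃)
open import Data.Sum using (_⊎_)
open import Data.Empty using (⊥)
open import Relation.Nullary using (¬_; Dec; yes; no; does)
open import Relation.Nullary.Decidable using (_⊎-dec_)
open import Relation.Binary.PropositionalEquality using (_≡_; _≢_)
open import Data.Bool using (if_then_else_)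

shift : ∀ {m} → Fin m → ℕ → Fin m
shift {suc m} i a = fromℕ< (m%n<n (toℕ i ℕ.+ a) (suc m))

-- vertices of G(m,j): outer v_i and inner u_i
data Vtx (m : ℕ) : Set where
  v : Fin m → Vtx m
  u : Fin m → Vtx m

-- directed edge list of G(m,j): v_i v_{i+1}, v_i u_i, u_i u_{i+j}
Edge : (m j : ℕ) → Vtx m → Vtx m → Set
Edge m j (v i) (v i') = i' ≡ shift i 1
Edge m j (v i) (u i') = i' ≡ i
Edge m j (u i) (u i') = i' ≡ shift i j
Edge m j (u i) (v i') = ⊥

edge? : (m j : ℕ) → (x y : Vtx m) → Dec (Edge m j x y)
edge? m j (v i) (v i') = i' ≟ᶠ shift i 1
edge? m j (v i) (u i') = i' ≟ᶠ i
edge? m j (u i) (u i') = i' ≟ᶠ shift i j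
edge? m j (u i) (v i') = no (λ ())

Adj : (m j : ℕ) → Vtx m → Vtx m → Set
Adj m j x y = Edge m j x y ⊎ Edge m j y x

adj? : (m j : ℕ) → (x y : Vtx m) → Dec (Adj m j x y)
adj? m j x y = edge? m j x y ⊎-dec edge? m j y x

allV : (m : ℕ) → List (Vtx m)
allV m = map v (allFin m) ++ map u (allFin m)

Labeling : ℕ → Set
Labeling m = Vtx m → ℤ

order : ∀ {m} → Labeling m → ℕ
order {m} ℓ = length (deduplicate _≟ℤ_ (map ℓ (allV m)))

Proper : (m j : ℕ) → Labeling m → Set
Proper m j ℓ = ∀ x y → Adj m j x y → ℓ x ≢ ℓ y

nbSum : (m j : ℕ) → Labeling m → Vtx m → ℤ
nbSum m j ℓ x = foldr ℤ._+_ (+ 0) (map (λ w → if does (adj? m j x w) then ℓ w else + 0) (allV m))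

OpenColoring : (m j n : ℕ) → ℤ → Labeling m → Set
OpenColoring m j n k ℓ = ∀ x → (+ n) ∣ (nbSum m j ℓ x ℤ.- k)

IsChi : (m j c : ℕ) → Set
IsChi m j c =
  (Σ (Labeling m) λ ℓ → Proper m j ℓ × order ℓ ≡ c) ×
  (∀ ℓ → Proper m j ℓ → c ≤ order ℓ)

ChiNKExists : (m j n : ℕ) → ℤ → Set
ChiNKExists m j n k = Σ (Labeling m) λ ℓ → Proper m j ℓ × OpenColoring m j n k ℓ

IsChiNK : (m j n : ℕ) → ℤ → ℕ → Set
IsChiNK m j n k c =
  (Σ (Labeling m) λ ℓ → Proper m j ℓ × OpenColoring m j n k ℓ × order ℓ ≡ c) ×
  (∀ ℓ → Proper m j ℓ → OpenColoring m j n k ℓ → c ≤ order ℓ)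

module Submission where

-- Every vertex of G(m,j) has exactly three neighbours: v_{i±1} and u_i for v_i, u_{i±j} and v_i
-- for u_i.  The colourings constructed all have the form ρ + n·ℓ with ℓ proper: adding
-- multiples of n leaves neighbourhood sums unchanged mod n, and keeps the colouring proper as
-- long as distinct values of ρ are incongruent mod n.
-- (1) If gcd(3,n) ∣ k, solve 3t ≡ k (mod n) and take ρ = t; the order does not grow.
-- (2) Summing the open condition over the 2m vertices counts every label three times, so
--     3·Σℓ ≡ 2m·k (mod n); if 3 ∣ n this forces 3 ∣ mk.
-- (3) If 3 ∣ m and 3 ∤ j, the three neighbours of any vertex have indices in the three different
--     classes mod 3, so ρ = k·[index ≡ 2 (mod 3)] has every neighbourhood sum equal to k; since
--     n ∤ k the two values of ρ are incongruent, and the order at most doubles.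
-- The minimum χ_{(n,k)} exists because an open colouring of order ≤ d can be relabelled into one
-- with labels below 2m·n, which makes the existence of an open colouring of order ≤ d decidable.

open import Defs
open import Algebra.Properties.CommutativeSemigroup using (interchange; x∙yz≈y∙xz)
open import Data.Bool using (true; false; if_then_else_)
open import Data.Empty using (⊥-elim)
open import Data.Fin using (Fin; toℕ; fromℕ<)
open import Data.Fin.Properties using (toℕ-fromℕ<; toℕ-injective; toℕ<n; any?) renaming (_≟_ to _≟ᶠ_)
open import Data.Integer as ℤ using (ℤ; +_)
open import Data.Integer.DivMod using (_%ℕ_; _/ℕ_; n%ℕd<d; a≡a%ℕn+[a/ℕn]*n)
open import Data.Integer.Divisibility using (_∣_)
open import Data.Integer.Divisibility.Signed
  using (divides; ∣ᵤ⇒∣; ∣⇒∣ᵤ; ∣m∣n⇒∣m+n; ∣m+n∣n⇒∣m; ∣m+n∣m⇒∣n; ∣m⇒∣-m)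
  renaming (_∣_ to _∣ˢ_; ∣-trans to ∣ˢ-trans)
import Data.Integer.Properties as ℤₚ
open import Algebra.Properties.AbelianGroup ℤₚ.+-0-abelianGroup using () renaming (∙-cancelˡ to +-cancelˡ)
open import Data.Integer.Properties using () renaming (_≟_ to _≟ℤ_)
open import Data.Integer.Tactic.RingSolver using (solve-∀)
open import Data.List using (List; []; _∷_; _++_; map; foldr; length; allFin; deduplicate; cartesianProductWith)
import Data.List.Properties as Listₚ
open import Data.List.Membership.Propositional using (_∈_; _∉_)
open import Data.List.Membership.Propositional.Properties
  using (∈-map⁺; ∈-map⁻; ∈-++⁺ˡ; ∈-++⁺ʳ; ∈-++⁻; ∈-∃++; ∈-allFin;
         ∈-deduplicate⁺; ∈-deduplicate⁻; ∈-cartesianProductWith⁺)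
open import Data.List.Relation.Binary.Disjoint.Propositional using (Disjoint)
open import Data.List.Relation.Binary.Subset.Propositional using (_⊆_)
open import Data.List.Relation.Unary.All as All using (All; []; _∷_)
open import Data.List.Relation.Unary.AllPairs using ([]; _∷_)
open import Data.List.Relation.Unary.Any as Any using (here; there)
open import Data.List.Relation.Unary.Unique.Propositional using (Unique)
open import Data.List.Relation.Unary.Unique.Propositional.Properties as Unique using (Unique[x∷xs]⇒x∉xs)
open import Data.List.Relation.Unary.Unique.DecPropositional.Properties _≟ℤ_ using (deduplicate-!)
open import Data.Nat as ℕ using (ℕ; zero; suc; _≤_; _<_; z≤n; s≤s; NonZero)
open import Data.Nat.Divisibility using (_∣?_; _∣0) renaming (_∣_ to _∣ℕ_)
open import Data.Nat.GCD using (gcd; gcd-greatest; gcd[m,n]∣m; gcd[m,n]∣n; gcd-GCD; module Bézout)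
open import Data.Nat.Primality using (Prime; prime?; prime⇒irreducible; euclidsLemma)
import Data.Nat.Properties as ℕₚ
open import Data.Nat.Tactic.RingSolver using () renaming (solve-∀ to ℕ-solve-∀)
open import Data.Product using (Σ; ∃; ∃₂; _×_; _,_)
open import Data.Sum using (_⊎_; inj₁; inj₂; [_,_]′; swap)
open import Data.Vec as Vec using (Vec; []; _∷_)
open import Data.Vec.Properties using (lookup∘tabulate)
open import Function using (id; const; _∘_; _⇔_; mk⇔; Equivalence)
open import Relation.Binary.Definitions using (DecidableEquality)
open import Relation.Binary.PropositionalEquality
  using (_≡_; _≢_; refl; sym; trans; cong; cong₂; subst; module ≡-Reasoning)
open import Relation.Nullary using (¬_; ¬?; Dec; yes; no; does; _×-dec_; _→-dec_)
open import Relation.Nullary.Decidable using (map′; from-yes; from-no; dec-true; dec-false; does-⇔)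
open import Relation.Unary using (Decidable)

private variable A B : Set

module _ where
  open import Data.Integer using (_+_; _*_)

  sumℤ : (A → ℤ) → List A → ℤ
  sumℤ f xs = foldr _+_ (+ 0) (map f xs)

  sumℤ-cong : {f g : A → ℤ} → (∀ x → f x ≡ g x) → ∀ xs → sumℤ f xs ≡ sumℤ g xs
  sumℤ-cong f≗g []       = refl
  sumℤ-cong f≗g (x ∷ xs) = cong₂ _+_ (f≗g x) (sumℤ-cong f≗g xs)

  sumℤ-zero : {f : A → ℤ} {xs : List A} → All (λ x → f x ≡ + 0) xs → sumℤ f xs ≡ + 0
  sumℤ-zero []             = refl
  sumℤ-zero (fx≡0 ∷ f≡0s) = cong₂ _+_ fx≡0 (sumℤ-zero f≡0s)

  sumℤ-distrib-+ : (f g : A → ℤ) (xs : List A) →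
                   sumℤ (λ x → f x + g x) xs ≡ sumℤ f xs + sumℤ g xs
  sumℤ-distrib-+ f g []       = refl
  sumℤ-distrib-+ f g (x ∷ xs) =
    trans (cong (_+_ (f x + g x)) (sumℤ-distrib-+ f g xs))
          (interchange ℤₚ.+-commutativeSemigroup (f x) (g x) _ _)

  sumℤ-*ˡ : (c : ℤ) (f : A → ℤ) (xs : List A) → sumℤ (λ x → c * f x) xs ≡ c * sumℤ f xs
  sumℤ-*ˡ c f []       = sym (ℤₚ.*-zeroʳ c)
  sumℤ-*ˡ c f (x ∷ xs) =
    trans (cong (_+_ (c * f x)) (sumℤ-*ˡ c f xs)) (sym (ℤₚ.*-distribˡ-+ c (f x) _))

  sumℤ-const : (c : ℤ) (xs : List A) → sumℤ (λ _ → c) xs ≡ + length xs * c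
  sumℤ-const c []       = sym (ℤₚ.*-zeroˡ c)
  sumℤ-const c (x ∷ xs) =
    trans (cong (_+_ c) (sumℤ-const c xs)) (sym (ℤₚ.suc-* (+ length xs) c))

  sumℤ-triple : (f : A → ℤ) (a b c : A) → sumℤ f (a ∷ b ∷ c ∷ []) ≡ f a + f b + f c
  sumℤ-triple f a b c =
    trans (cong (λ s → f a + (f b + s)) (ℤₚ.+-identityʳ (f c))) (sym (ℤₚ.+-assoc (f a) (f b) (f c)))

  sumℤ-swap : (F : A → B → ℤ) (xs : List A) (ys : List B) →
              sumℤ (λ x → sumℤ (F x) ys) xs ≡ sumℤ (λ y → sumℤ (λ x → F x y) xs) ys
  sumℤ-swap F []       ys = sym (sumℤ-zero {f = λ _ → + 0} {xs = ys} (All.tabulate (λ _ → refl)))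
  sumℤ-swap F (x ∷ xs) ys = trans (cong (_+_ (sumℤ (F x) ys)) (sumℤ-swap F xs ys))
                                  (sym (sumℤ-distrib-+ (F x) _ ys))

  sumℤ-∣ : {d : ℤ} {f : A → ℤ} (xs : List A) → (∀ x → d ∣ˢ f x) → d ∣ˢ sumℤ f xs
  sumℤ-∣ {d = d} []       _   = divides (+ 0) (sym (ℤₚ.*-zeroˡ d))
  sumℤ-∣         (x ∷ xs) d∣f = ∣m∣n⇒∣m+n (d∣f x) (sumℤ-∣ xs d∣f)

  -- nbSum m j ℓ x is by definition sumℤ (indicator (adj? m j x) ℓ) (allV m).
  indicator : {P : A → Set} → Decidable P → (A → ℤ) → A → ℤ
  indicator P? f x = if does (P? x) then f x else + 0

  module _ {P : A → Set} (P? : Decidable P) (f : A → ℤ) {x : A} where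

    indicator-accept : P x → indicator P? f x ≡ f x
    indicator-accept px = cong (if_then f x else + 0) (dec-true (P? x) px)

    indicator-reject : ¬ P x → indicator P? f x ≡ + 0
    indicator-reject ¬px = cong (if_then f x else + 0) (dec-false (P? x) ¬px)

  indicator-⇔ : {P Q : A → Set} (P? : Decidable P) (Q? : Decidable Q) (f : A → ℤ) →
                (∀ x → P x ⇔ Q x) → ∀ x → indicator P? f x ≡ indicator Q? f x
  indicator-⇔ P? Q? f P⇔Q x = cong (if_then f x else + 0) (does-⇔ (P⇔Q x) (P? x) (Q? x))

module _ (_≟_ : DecidableEquality A) where
  open import Data.Integer using (_+_)
  open import Data.List.Membership.DecPropositional _≟_ using (_∈?_)

  sumℤ-indicator-≡ : (f : A → ℤ) {a : A} {xs : List A} → Unique xs → a ∈ xs →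
                     sumℤ (indicator (_≟ a) f) xs ≡ f a
  sumℤ-indicator-≡ f {a} (a∉ys ∷ _) (here refl) = trans
    (cong₂ _+_ (indicator-accept (_≟ a) f refl)
               (sumℤ-zero (All.map (λ a≢w → indicator-reject (_≟ a) f (a≢w ∘ sym)) a∉ys)))
    (ℤₚ.+-identityʳ _)
  sumℤ-indicator-≡ f {a} (y∉ys ∷ !ys) (there a∈ys) = trans
    (cong₂ _+_ (indicator-reject (_≟ a) f (All.lookup y∉ys a∈ys))
               (sumℤ-indicator-≡ f !ys a∈ys))
    (ℤₚ.+-identityˡ _)

  indicator-∈-∷ : (f : A → ℤ) {a : A} {N : List A} → a ∉ N → ∀ w →
                  indicator (_∈? a ∷ N) f w ≡ indicator (_≟ a) f w + indicator (_∈? N) f w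
  indicator-∈-∷ f {a} {N} a∉N w with w ≟ a | w ∈? N
  ... | yes refl | yes w∈N = ⊥-elim (a∉N w∈N)
  ... | yes refl | no _     = sym (ℤₚ.+-identityʳ (f w))
  ... | no _     | yes _    = sym (ℤₚ.+-identityˡ (f w))
  ... | no _     | no _     = refl

  sumℤ-indicator-∈ : (f : A → ℤ) {xs N : List A} → Unique xs → Unique N → N ⊆ xs →
                     sumℤ (indicator (_∈? N) f) xs ≡ sumℤ f N
  sumℤ-indicator-∈ f {xs} {[]}    _   _             _    =
    sumℤ-zero {xs = xs} (All.tabulate (λ _ → refl))
  sumℤ-indicator-∈ f {xs} {a ∷ N} !xs !aN@(_ ∷ !N) N⊆xs = begin
    sumℤ (indicator (_∈? a ∷ N) f) xs
      ≡⟨ sumℤ-cong (indicator-∈-∷ f (Unique[x∷xs]⇒x∉xs !aN)) xs ⟩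
    sumℤ (λ w → indicator (_≟ a) f w + indicator (_∈? N) f w) xs
      ≡⟨ sumℤ-distrib-+ _ _ xs ⟩
    sumℤ (indicator (_≟ a) f) xs + sumℤ (indicator (_∈? N) f) xs
      ≡⟨ cong₂ _+_ (sumℤ-indicator-≡ f !xs (N⊆xs (here refl)))
                   (sumℤ-indicator-∈ f !xs !N (λ w∈N → N⊆xs (there w∈N))) ⟩
    f a + sumℤ f N ∎
    where open ≡-Reasoning

module _ where
  open import Data.Nat using (_+_; _*_)

  unique⊆⇒length≤ : {xs ys : List A} → Unique xs → xs ⊆ ys → length xs ≤ length ys
  unique⊆⇒length≤ {xs = []}     _             _    = z≤n
  unique⊆⇒length≤ {xs = x ∷ xs} (x∉xs ∷ !xs) x∷xs⊆ys with ∈-∃++ (x∷xs⊆ys (here refl))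
  ... | ys₁ , ys₂ , refl = subst (suc (length xs) ≤_) (sym (Listₚ.length-++-sucʳ ys₁ x ys₂))
                                 (s≤s (unique⊆⇒length≤ !xs xs⊆ys₁++ys₂))
    where
    xs⊆ys₁++ys₂ : xs ⊆ ys₁ ++ ys₂
    xs⊆ys₁++ys₂ z∈xs with ∈-++⁻ ys₁ (x∷xs⊆ys (there z∈xs))
    ... | inj₁ z∈ys₁          = ∈-++⁺ˡ z∈ys₁
    ... | inj₂ (here z≡x)     = ⊥-elim (All.lookup x∉xs z∈xs (sym z≡x))
    ... | inj₂ (there z∈ys₂) = ∈-++⁺ʳ ys₁ z∈ys₂

  length-cartesianProductWith : {C : Set} (f : A → B → C) (xs : List A) (ys : List B) →
                                length (cartesianProductWith f xs ys) ≡ length xs * length ys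
  length-cartesianProductWith f []       ys = refl
  length-cartesianProductWith f (x ∷ xs) ys = begin
    length (map (f x) ys ++ cartesianProductWith f xs ys)
      ≡⟨ Listₚ.length-++ (map (f x) ys) ⟩
    length (map (f x) ys) + length (cartesianProductWith f xs ys)
      ≡⟨ cong₂ _+_ (Listₚ.length-map (f x) ys) (length-cartesianProductWith f xs ys) ⟩
    length ys + length xs * length ys ∎
    where open ≡-Reasoning

module _ where
  open import Data.Nat using (_+_; _∸_; _%_)
  open import Data.Nat.DivMod using (m%n<n; %-distribˡ-+; m%n%n≡m%n; [m+n]%n≡m%n; m<n⇒m%n≡m)

  [m%d+n]%d≡[m+n]%d : ∀ x y d .{{_ : NonZero d}} → (x % d + y) % d ≡ (x + y) % d
  [m%d+n]%d≡[m+n]%d x y d = begin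
    (x % d + y) % d             ≡⟨ %-distribˡ-+ (x % d) y d ⟩
    (x % d % d + y % d) % d     ≡⟨ cong (λ r → (r + y % d) % d) (m%n%n≡m%n x d) ⟩
    (x % d + y % d) % d         ≡⟨ %-distribˡ-+ x y d ⟨
    (x + y) % d                 ∎
    where open ≡-Reasoning

  module _ {p : ℕ} where

    toℕ-shift : (i : Fin (suc p)) (a : ℕ) → toℕ (shift i a) ≡ (toℕ i + a) % suc p
    toℕ-shift i a = toℕ-fromℕ< (m%n<n (toℕ i + a) (suc p))

    toℕ-shift-shift : (i : Fin (suc p)) (a b : ℕ) →
                      toℕ (shift (shift i a) b) ≡ (toℕ i + (a + b)) % suc p
    toℕ-shift-shift i a b = begin
      toℕ (shift (shift i a) b)          ≡⟨ toℕ-shift (shift i a) b ⟩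
      (toℕ (shift i a) + b) % suc p      ≡⟨ cong (λ r → (r + b) % suc p) (toℕ-shift i a) ⟩
      ((toℕ i + a) % suc p + b) % suc p  ≡⟨ [m%d+n]%d≡[m+n]%d (toℕ i + a) b (suc p) ⟩
      (toℕ i + a + b) % suc p            ≡⟨ cong (_% suc p) (ℕₚ.+-assoc (toℕ i) a b) ⟩
      (toℕ i + (a + b)) % suc p          ∎
      where open ≡-Reasoning

    shift-inverse : (i : Fin (suc p)) {a b : ℕ} → a + b ≡ suc p → shift (shift i a) b ≡ i
    shift-inverse i {a} {b} a+b≡m = toℕ-injective (begin
      toℕ (shift (shift i a) b)    ≡⟨ toℕ-shift-shift i a b ⟩
      (toℕ i + (a + b)) % suc p    ≡⟨ cong (λ s → (toℕ i + s) % suc p) a+b≡m ⟩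
      (toℕ i + suc p) % suc p      ≡⟨ [m+n]%n≡m%n (toℕ i) (suc p) ⟩
      toℕ i % suc p                ≡⟨ m<n⇒m%n≡m (toℕ<n i) ⟩
      toℕ i                        ∎)
      where open ≡-Reasoning

    shift-flip : {i i′ : Fin (suc p)} {a b : ℕ} → a + b ≡ suc p → i ≡ shift i′ a → i′ ≡ shift i b
    shift-flip a+b≡m refl = sym (shift-inverse _ a+b≡m)

    shift-injective : (i : Fin (suc p)) {a b : ℕ} → a < suc p → b < suc p →
                      shift i a ≡ shift i b → a ≡ b
    shift-injective i {a} {b} a<m b<m eq =
      trans (sym (unshift a<m)) (trans (cong (λ i′ → toℕ (shift i′ c)) eq) (unshift b<m))
      where
      c = suc p ∸ toℕ i
      unshift : ∀ {a} → a < suc p → toℕ (shift (shift i a) c) ≡ a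
      unshift {a} a<m = begin
        toℕ (shift (shift i a) c)
          ≡⟨ toℕ-shift-shift i a c ⟩
        (toℕ i + (a + c)) % suc p
          ≡⟨ cong (_% suc p) (x∙yz≈y∙xz ℕₚ.+-commutativeSemigroup (toℕ i) a c) ⟩
        (a + (toℕ i + c)) % suc p
          ≡⟨ cong (λ s → (a + s) % suc p) (ℕₚ.m+[n∸m]≡n (ℕₚ.<⇒≤ (toℕ<n i))) ⟩
        (a + suc p) % suc p        ≡⟨ [m+n]%n≡m%n a (suc p) ⟩
        a % suc p                  ≡⟨ m<n⇒m%n≡m a<m ⟩
        a                          ∎
        where open ≡-Reasoning

module _ {m : ℕ} where

  v-injective : {i i′ : Fin m} → v i ≡ v i′ → i ≡ i′
  v-injective refl = refl

  u-injective : {i i′ : Fin m} → u i ≡ u i′ → i ≡ i′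
  u-injective refl = refl

  _≟ᵥ_ : DecidableEquality (Vtx m)
  v i ≟ᵥ v i′ = map′ (cong v) v-injective (i ≟ᶠ i′)
  v i ≟ᵥ u i′ = no λ ()
  u i ≟ᵥ v i′ = no λ ()
  u i ≟ᵥ u i′ = map′ (cong u) u-injective (i ≟ᶠ i′)

  index : Vtx m → Fin m
  index (v i) = i
  index (u i) = i

  ∈-allV : (x : Vtx m) → x ∈ allV m
  ∈-allV (v i) = ∈-++⁺ˡ (∈-map⁺ v (∈-allFin i))
  ∈-allV (u i) = ∈-++⁺ʳ (map v (allFin m)) (∈-map⁺ u (∈-allFin i))

  allV-unique : Unique (allV m)
  allV-unique = Unique.++⁺ (Unique.map⁺ v-injective (Unique.allFin⁺ m))
                           (Unique.map⁺ u-injective (Unique.allFin⁺ m))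
                           outer∩inner≡∅
    where
    outer∩inner≡∅ : Disjoint (map v (allFin m)) (map u (allFin m))
    outer∩inner≡∅ (x∈vs , x∈us) with ∈-map⁻ v x∈vs | ∈-map⁻ u x∈us
    ... | _ , _ , refl | _ , _ , ()

  length-allV : length (allV m) ≡ m ℕ.+ m
  length-allV = trans (Listₚ.length-++ (map v (allFin m)))
                      (cong₂ ℕ._+_ (length-map-allFin v) (length-map-allFin u))
    where
    length-map-allFin : (f : Fin m → Vtx m) → length (map f (allFin m)) ≡ m
    length-map-allFin f = trans (Listₚ.length-map f (allFin m)) (Listₚ.length-tabulate id)

  ∀-Vtx? : {P : Vtx m → Set} → Decidable P → Dec (∀ x → P x)
  ∀-Vtx? P? = map′ (λ all x → All.lookup all (∈-allV x)) (λ ∀P → All.tabulate (λ {x} _ → ∀P x))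
                   (All.all? P? (allV m))

  module _ where
    open import Data.Integer using (_+_; _*_)

    lift : ℕ → Labeling m → Labeling m → Labeling m
    lift N ρ ℓ x = ρ x + + N * ℓ x

    order-≤-* : (R : List ℤ) (h : ℤ → ℤ → ℤ) {ℓ ℓ′ : Labeling m} →
                (∀ x → ∃ λ r → r ∈ R × ℓ′ x ≡ h r (ℓ x)) → order ℓ′ ≤ length R ℕ.* order ℓ
    order-≤-* R h {ℓ} {ℓ′} ℓ′≡h[r,ℓ] = begin
      order ℓ′                                    ≤⟨ unique⊆⇒length≤ (deduplicate-! _) range⊆ ⟩
      length (cartesianProductWith h R range[ℓ])  ≡⟨ length-cartesianProductWith h R range[ℓ] ⟩
      length R ℕ.* order ℓ                        ∎
      where
      open ℕₚ.≤-Reasoning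
      range[ℓ] = deduplicate _≟ℤ_ (map ℓ (allV m))
      range⊆ : deduplicate _≟ℤ_ (map ℓ′ (allV m)) ⊆ cartesianProductWith h R range[ℓ]
      range⊆ z∈ with ∈-map⁻ ℓ′ (∈-deduplicate⁻ _≟ℤ_ (map ℓ′ (allV m)) z∈)
      ... | x , _ , refl with ℓ′≡h[r,ℓ] x
      ... | r , r∈R , ℓ′x≡ = subst (_∈ _) (sym ℓ′x≡)
            (∈-cartesianProductWith⁺ h r∈R (∈-deduplicate⁺ _≟ℤ_ (∈-map⁺ ℓ (∈-allV x))))

module _ {m j : ℕ} where
  open import Data.Integer using (_+_; _-_; _*_)

  nbSum-cong : {ℓ ℓ′ : Labeling m} → (∀ x → ℓ x ≡ ℓ′ x) →
               ∀ x → nbSum m j ℓ x ≡ nbSum m j ℓ′ x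
  nbSum-cong ℓ≗ℓ′ x =
    sumℤ-cong (λ w → cong (if does (adj? m j x w) then_else + 0) (ℓ≗ℓ′ w)) (allV m)

  nbSum-lift : (N : ℕ) (ρ ℓ : Labeling m) (x : Vtx m) →
               nbSum m j (lift N ρ ℓ) x ≡ nbSum m j ρ x + + N * nbSum m j ℓ x
  nbSum-lift N ρ ℓ x = begin
    sumℤ (indicator (adj? m j x) (lift N ρ ℓ)) (allV m)
      ≡⟨ sumℤ-cong (λ w → if-distrib (does (adj? m j x w)) w) (allV m) ⟩
    sumℤ (λ w → indicator (adj? m j x) ρ w + + N * indicator (adj? m j x) ℓ w) (allV m)
      ≡⟨ sumℤ-distrib-+ _ _ (allV m) ⟩
    nbSum m j ρ x + sumℤ (λ w → + N * indicator (adj? m j x) ℓ w) (allV m)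
      ≡⟨ cong (_+_ (nbSum m j ρ x)) (sumℤ-*ˡ (+ N) _ (allV m)) ⟩
    nbSum m j ρ x + + N * nbSum m j ℓ x ∎
    where
    open ≡-Reasoning
    if-distrib : ∀ b w → (if b then lift N ρ ℓ w else + 0) ≡
                         (if b then ρ w else + 0) + + N * (if b then ℓ w else + 0)
    if-distrib true  w = refl
    if-distrib false w = sym (trans (ℤₚ.+-identityˡ _) (ℤₚ.*-zeroʳ (+ N)))

  module _ {N : ℕ} {k : ℤ} where

    openColoring-cong : {ℓ ℓ′ : Labeling m} → (∀ x → ℓ x ≡ ℓ′ x) →
                        OpenColoring m j N k ℓ → OpenColoring m j N k ℓ′
    openColoring-cong ℓ≗ℓ′ ℓ-open x = subst (λ s → + N ∣ s - k) (nbSum-cong ℓ≗ℓ′ x) (ℓ-open x)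

    lift-open⇔ : (ρ ℓ : Labeling m) → OpenColoring m j N k (lift N ρ ℓ) ⇔ OpenColoring m j N k ρ
    lift-open⇔ ρ ℓ = mk⇔
      (λ lift-open x → ∣⇒∣ᵤ {+ N} {nbSum m j ρ x - k}
        (∣m+n∣n⇒∣m (subst (+ N ∣ˢ_) (split x)
                          (∣ᵤ⇒∣ {+ N} {nbSum m j (lift N ρ ℓ) x - k} (lift-open x)))
                   (N∣N* x)))
      (λ ρ-open x → ∣⇒∣ᵤ {+ N} {nbSum m j (lift N ρ ℓ) x - k}
        (subst (+ N ∣ˢ_) (sym (split x))
               (∣m∣n⇒∣m+n (∣ᵤ⇒∣ {+ N} {nbSum m j ρ x - k} (ρ-open x)) (N∣N* x))))
      where
      N∣N* : ∀ x → + N ∣ˢ + N * nbSum m j ℓ x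
      N∣N* x = divides (nbSum m j ℓ x) (ℤₚ.*-comm (+ N) _)
      split : ∀ x → nbSum m j (lift N ρ ℓ) x - k ≡ (nbSum m j ρ x - k) + + N * nbSum m j ℓ x
      split x = trans (cong (_- k) (nbSum-lift N ρ ℓ x)) (rearrange (nbSum m j ρ x) _ k)
        where
        rearrange : ∀ a b c → (a + b) - c ≡ (a - c) + b
        rearrange = solve-∀

  lift-proper : (N : ℕ) .{{_ : NonZero N}} (ρ ℓ : Labeling m) →
                (∀ x y → + N ∣ ρ x - ρ y → ρ x ≡ ρ y) → Proper m j ℓ → Proper m j (lift N ρ ℓ)
  lift-proper N ρ ℓ ρ-separated ℓ-proper x y x~y lift[x]≡lift[y] = ℓ-proper x y x~y ℓx≡ℓy
    where
    open ≡-Reasoning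
    ρx-ρy≡ : ρ x - ρ y ≡ (ℓ y - ℓ x) * + N
    ρx-ρy≡ = begin
      ρ x - ρ y
        ≡⟨ expand (ρ x) (ρ y) (ℓ x) (ℓ y) (+ N) ⟩
      (lift N ρ ℓ x - lift N ρ ℓ y) + (ℓ y - ℓ x) * + N
        ≡⟨ cong (λ z → (z - lift N ρ ℓ y) + (ℓ y - ℓ x) * + N) lift[x]≡lift[y] ⟩
      (lift N ρ ℓ y - lift N ρ ℓ y) + (ℓ y - ℓ x) * + N
        ≡⟨ cancel (lift N ρ ℓ y) _ ⟩
      (ℓ y - ℓ x) * + N ∎
      where
      expand : ∀ a b c d n → a - b ≡ ((a + n * c) - (b + n * d)) + (d - c) * n
      expand = solve-∀
      cancel : ∀ a b → (a - a) + b ≡ b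
      cancel = solve-∀
    ρx≡ρy : ρ x ≡ ρ y
    ρx≡ρy = ρ-separated x y (∣⇒∣ᵤ {+ N} {ρ x - ρ y} (divides (ℓ y - ℓ x) ρx-ρy≡))
    ℓx≡ℓy : ℓ x ≡ ℓ y
    ℓx≡ℓy = ℤₚ.*-cancelˡ-≡ (+ N) (ℓ x) (ℓ y)
              (+-cancelˡ (ρ x) _ _ (trans lift[x]≡lift[y] (cong (λ r → r + + N * ℓ y) (sym ρx≡ρy))))

module _ where
  open import Data.Nat using (_+_; _*_; _%_)
  open import Data.Nat.DivMod using (m%n<n; %-distribˡ-+; %-remove-+ʳ; m∣n⇒o%n%m≡o%m)
  open import Data.Nat.Divisibility using (m%n≡0⇒n∣m; ∣-refl; ∣-trans; 1∣_)

  δ₂ : ℕ → ℕ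
  δ₂ 2 = 1
  δ₂ _ = 0

  δ₂-0∨1 : ∀ r → δ₂ r ≡ 0 ⊎ δ₂ r ≡ 1
  δ₂-0∨1 0                   = inj₁ refl
  δ₂-0∨1 1                   = inj₁ refl
  δ₂-0∨1 2                   = inj₂ refl
  δ₂-0∨1 (suc (suc (suc _))) = inj₁ refl

  δ₂-residues : ∀ y s → y < 3 → s < 3 → s ≢ 0 →
                δ₂ (((y + s) % 3 + s) % 3) + δ₂ y + δ₂ ((y + s) % 3) ≡ 1
  δ₂-residues _ 0 _ _ s≢0 = ⊥-elim (s≢0 refl)
  δ₂-residues 0 1 _ _ _ = refl
  δ₂-residues 0 2 _ _ _ = refl
  δ₂-residues 1 1 _ _ _ = refl
  δ₂-residues 1 2 _ _ _ = refl
  δ₂-residues 2 1 _ _ _ = refl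
  δ₂-residues 2 2 _ _ _ = refl
  δ₂-residues (suc (suc (suc _))) _ (s≤s (s≤s (s≤s ()))) _ _
  δ₂-residues _ (suc (suc (suc _))) _ (s≤s (s≤s (s≤s ()))) _

  -- With 3 ∣ m and a + b = m, the indices i + a, i + b and i fall in the residues y + 2s, y and
  -- y + s mod 3, where y = (i + b) mod 3 and s = a mod 3 ≢ 0: one of each class.
  δ₂-shift-sum : ∀ {p a b} → 3 ∣ℕ suc p → ¬ 3 ∣ℕ a → a + b ≡ suc p → (i : Fin (suc p)) →
                 δ₂ (toℕ (shift i a) % 3) + δ₂ (toℕ (shift i b) % 3) + δ₂ (toℕ i % 3) ≡ 1
  δ₂-shift-sum {p} {a} {b} 3∣m 3∤a a+b≡m i = begin
    δ₂ (toℕ (shift i a) % 3) + δ₂ (toℕ (shift i b) % 3) + δ₂ (x % 3)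
      ≡⟨ cong₂ (λ r r′ → δ₂ r + δ₂ r′ + δ₂ (x % 3)) (shift%3 a) (shift%3 b) ⟩
    δ₂ ((x + a) % 3) + δ₂ y + δ₂ (x % 3)
      ≡⟨ cong₂ (λ r r′ → δ₂ r + δ₂ y + δ₂ r′) x+a≡y+s+s x≡y+s ⟩
    δ₂ (((y + s) % 3 + s) % 3) + δ₂ y + δ₂ ((y + s) % 3)
      ≡⟨ δ₂-residues y s (m%n<n (x + b) 3) (m%n<n a 3) (3∤a ∘ m%n≡0⇒n∣m a 3) ⟩
    1 ∎
    where
    open ≡-Reasoning
    x = toℕ i
    y = (x + b) % 3
    s = a % 3
    shift%3 : ∀ c → toℕ (shift i c) % 3 ≡ (x + c) % 3
    shift%3 c = trans (cong (_% 3) (toℕ-shift i c)) (m∣n⇒o%n%m≡o%m 3 (suc p) (x + c) 3∣m)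
    x≡y+s : x % 3 ≡ (y + s) % 3
    x≡y+s = begin
      x % 3               ≡⟨ %-remove-+ʳ x 3∣m ⟨
      (x + suc p) % 3     ≡⟨ cong (λ c → (x + c) % 3) (trans (sym a+b≡m) (ℕₚ.+-comm a b)) ⟩
      (x + (b + a)) % 3   ≡⟨ cong (_% 3) (ℕₚ.+-assoc x b a) ⟨
      (x + b + a) % 3     ≡⟨ %-distribˡ-+ (x + b) a 3 ⟩
      (y + s) % 3         ∎
    x+a≡y+s+s : (x + a) % 3 ≡ ((y + s) % 3 + s) % 3
    x+a≡y+s+s = trans (%-distribˡ-+ x a 3) (cong (λ r → (r + s) % 3) x≡y+s)

  prime-3 : Prime 3
  prime-3 = from-yes (prime? 3)

  gcd∣⇔ : ∀ {q} n {a} → Prime q → gcd q n ∣ℕ a ⇔ (q ∣ℕ n → q ∣ℕ a)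
  gcd∣⇔ {q} n {a} q-prime = mk⇔
    (λ g∣a q∣n → ∣-trans (gcd-greatest ∣-refl q∣n) g∣a)
    (λ q∣n⇒q∣a → [ (λ g≡1 → subst (_∣ℕ a) (sym g≡1) (1∣ a))
                 , (λ g≡q → subst (_∣ℕ a) (sym g≡q)
                                  (q∣n⇒q∣a (subst (_∣ℕ n) g≡q (gcd[m,n]∣n q n))))
                 ]′ (prime⇒irreducible q-prime (gcd[m,n]∣m q n)))

  ∣2*⇒∣ : ∀ {q} x → Prime q → ¬ q ∣ℕ 2 → q ∣ℕ 2 * x → q ∣ℕ x
  ∣2*⇒∣ x q-prime q∤2 q∣2x = [ ⊥-elim ∘ q∤2 , id ]′ (euclidsLemma 2 x q-prime q∣2x)

  gcd∤a∧gcd∣ab⇒∣b : ∀ {q} n {a b} → Prime q → ¬ gcd q n ∣ℕ a → gcd q n ∣ℕ a * b → q ∣ℕ b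
  gcd∤a∧gcd∣ab⇒∣b {q} n {a} {b} q-prime g∤a g∣ab with q ∣? n
  ... | no q∤n  = ⊥-elim (g∤a (Equivalence.from (gcd∣⇔ n q-prime) (⊥-elim ∘ q∤n)))
  ... | yes q∣n = [ ⊥-elim ∘ g∤a ∘ Equivalence.from (gcd∣⇔ n q-prime) ∘ const , id ]′
                  (euclidsLemma a b q-prime (Equivalence.to (gcd∣⇔ n q-prime) g∣ab q∣n))

module _ where
  open import Data.Integer using (_+_; _-_; _*_; -_)

  pos-+-* : ∀ {d x a y n} → d ℕ.+ x ℕ.* a ≡ y ℕ.* n → + d + + x * + a ≡ + y * + n
  pos-+-* {d} {x} {a} {y} {n} eq = begin
    + d + + x * + a      ≡⟨ cong (_+_ (+ d)) (ℤₚ.pos-* x a) ⟨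
    + d + + (x ℕ.* a)    ≡⟨ ℤₚ.pos-+ d (x ℕ.* a) ⟨
    + (d ℕ.+ x ℕ.* a)    ≡⟨ cong +_ eq ⟩
    + (y ℕ.* n)          ≡⟨ ℤₚ.pos-* y n ⟩
    + y * + n            ∎
    where open ≡-Reasoning

  linear-congruence : ∀ a n {k} → + gcd a n ∣ k → ∃ λ t → + n ∣ + a * t - k
  linear-congruence a n {k} g∣k
    with ∣ᵤ⇒∣ {+ gcd a n} {k} g∣k | Bézout.identity (gcd-GCD a n)
  ... | divides q refl | Bézout.+- x y g+yn≡xa =
    q * + x , ∣⇒∣ᵤ {+ n} {+ a * (q * + x) - q * + g} (divides (q * + y) (begin
      + a * (q * + x) - q * + g       ≡⟨ r₁ (+ a) q (+ x) (+ g) ⟩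
      q * (+ x * + a) - q * + g
        ≡⟨ cong (λ z → q * z - q * + g) (sym (pos-+-* {g} {y} {n} {x} {a} g+yn≡xa)) ⟩
      q * (+ g + + y * + n) - q * + g ≡⟨ r₂ q (+ g) (+ y) (+ n) ⟩
      q * + y * + n                   ∎))
    where
    open ≡-Reasoning
    g = gcd a n
    r₁ : ∀ a q x g → a * (q * x) - q * g ≡ q * (x * a) - q * g
    r₁ = solve-∀
    r₂ : ∀ q g y n → q * (g + y * n) - q * g ≡ q * y * n
    r₂ = solve-∀
  ... | divides q refl | Bézout.-+ x y g+xa≡yn =
    - (q * + x) , ∣⇒∣ᵤ {+ n} {+ a * - (q * + x) - q * + g} (divides (- (q * + y)) (begin
      + a * - (q * + x) - q * + g     ≡⟨ r₁ (+ a) q (+ x) (+ g) ⟩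
      - (q * (+ g + + x * + a))
        ≡⟨ cong (λ z → - (q * z)) (pos-+-* {g} {x} {a} {y} {n} g+xa≡yn) ⟩
      - (q * (+ y * + n))             ≡⟨ r₂ q (+ y) (+ n) ⟩
      - (q * + y) * + n               ∎))
    where
    open ≡-Reasoning
    g = gcd a n
    r₁ : ∀ a q x g → a * - (q * x) - q * g ≡ - (q * (g + x * a))
    r₁ = solve-∀
    r₂ : ∀ q y n → - (q * (y * n)) ≡ - (q * y) * n
    r₂ = solve-∀

-- Existence of the minimum

module _ {P : ℕ → Set} (P? : Decidable P) where

  least-below : ∀ b → (∃ λ d → d < b × P d × (∀ {e} → P e → d ≤ e)) ⊎ (∀ {e} → e < b → ¬ P e)
  least-below zero = inj₂ λ ()
  least-below (suc b) with least-below b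
  ... | inj₁ (d , d<b , Pd , d-min) = inj₁ (d , ℕₚ.m<n⇒m<1+n d<b , Pd , d-min)
  ... | inj₂ ¬P<b with P? b
  ...   | yes Pb = inj₁ (b , ℕₚ.n<1+n b , Pb , λ Pe → ℕₚ.≮⇒≥ (λ e<b → ¬P<b e<b Pe))
  ...   | no ¬Pb = inj₂ λ e<1+b Pe →
    [ (λ e<b → ¬P<b e<b Pe) , (λ e≡b → ¬Pb (subst P e≡b Pe)) ]′ (ℕₚ.m<1+n⇒m<n∨m≡n e<1+b)

  least : ∀ {b} → P b → ∃ λ d → P d × (∀ {e} → P e → d ≤ e)
  least {b} Pb with least-below (suc b)
  ... | inj₁ (d , _ , Pd , d-min) = d , Pd , d-min
  ... | inj₂ ¬P≤b                 = ⊥-elim (¬P≤b (ℕₚ.n<1+n b) Pb)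

∃-Vec? : ∀ {B} len {Q : Vec (Fin B) len → Set} → (∀ xs → Dec (Q xs)) → Dec (∃ Q)
∃-Vec? zero      Q? = map′ ([] ,_) (λ { ([] , q) → q }) (Q? [])
∃-Vec? (suc len) Q? = map′ (λ (a , xs , q) → a ∷ xs , q) (λ { (a ∷ xs , q) → a , xs , q })
                           (any? λ a → ∃-Vec? len (λ xs → Q? (a ∷ xs)))

module _ where
  open import Data.Nat using (_+_; _*_; _%_)
  open import Data.Nat.DivMod using ([m+kn]%n≡m%n; m<n⇒m%n≡m)

  indexOf : ℤ → List ℤ → ℕ
  indexOf z []       = 0
  indexOf z (y ∷ ys) with z ≟ℤ y
  ... | yes _ = 0
  ... | no _  = suc (indexOf z ys)

  indexOf-< : ∀ {z L} → z ∈ L → indexOf z L < length L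
  indexOf-< {z} {y ∷ ys} z∈ with z ≟ℤ y
  ... | yes _  = s≤s z≤n
  ... | no z≢y = s≤s (indexOf-< (Any.tail z≢y z∈))

  indexOf-injective : ∀ {a b L} → a ∈ L → b ∈ L → indexOf a L ≡ indexOf b L → a ≡ b
  indexOf-injective {a} {b} {y ∷ ys} a∈ b∈ eq with a ≟ℤ y | b ≟ℤ y
  ... | yes a≡y | yes b≡y = trans a≡y (sym b≡y)
  ... | yes _   | no _    = ⊥-elim (ℕₚ.0≢1+n eq)
  ... | no _    | yes _   = ⊥-elim (ℕₚ.1+n≢0 eq)
  ... | no a≢y  | no b≢y  =
    indexOf-injective (Any.tail a≢y a∈) (Any.tail b≢y b∈) (ℕₚ.suc-injective eq)

  module _ (N : ℕ) .{{_ : NonZero N}} (L : List ℤ) where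

    compress : ℤ → ℕ
    compress z = z %ℕ N + indexOf z L * N

    compress-< : ∀ {z} → z ∈ L → compress z < length L * N
    compress-< {z} z∈ = ℕₚ.<-≤-trans (ℕₚ.+-monoˡ-< (indexOf z L * N) (n%ℕd<d z N))
                                    (ℕₚ.*-monoˡ-≤ N (indexOf-< z∈))

    compress-injective : ∀ {a b} → a ∈ L → b ∈ L → compress a ≡ compress b → a ≡ b
    compress-injective {a} {b} a∈ b∈ eq = indexOf-injective a∈ b∈
      (ℕₚ.*-cancelʳ-≡ _ _ N (ℕₚ.+-cancelˡ-≡ (a %ℕ N) _ _
        (trans eq (cong (_+ indexOf b L * N) (sym a≡b[N])))))
      where
      compress%N : ∀ z → compress z % N ≡ z %ℕ N
      compress%N z = trans ([m+kn]%n≡m%n (z %ℕ N) (indexOf z L) N) (m<n⇒m%n≡m (n%ℕd<d z N))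
      a≡b[N] : a %ℕ N ≡ b %ℕ N
      a≡b[N] = trans (sym (compress%N a)) (trans (cong (_% N) eq) (compress%N b))

    compress-as-lift : ∀ z → + compress z ≡ + (z %ℕ N) ℤ.+ + N ℤ.* + indexOf z L
    compress-as-lift z = begin
      + (z %ℕ N + indexOf z L * N)
        ≡⟨ ℤₚ.pos-+ (z %ℕ N) _ ⟩
      + (z %ℕ N) ℤ.+ + (indexOf z L * N)
        ≡⟨ cong (ℤ._+_ (+ (z %ℕ N))) (ℤₚ.pos-* (indexOf z L) N) ⟩
      + (z %ℕ N) ℤ.+ + indexOf z L ℤ.* + N
        ≡⟨ cong (ℤ._+_ (+ (z %ℕ N))) (ℤₚ.*-comm (+ indexOf z L) (+ N)) ⟩
      + (z %ℕ N) ℤ.+ + N ℤ.* + indexOf z L ∎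
      where open ≡-Reasoning

OpenColorable≤ : (m j n : ℕ) → ℤ → ℕ → Set
OpenColorable≤ m j n k d = Σ (Labeling m) λ ℓ → Proper m j ℓ × OpenColoring m j n k ℓ × order ℓ ≤ d

chi≤chiNK : ∀ {m j n k c c′} → IsChi m j c → IsChiNK m j n k c′ → c ≤ c′
chi≤chiNK {c = c} (_ , c-min) ((ℓ , ℓ-proper , _ , order≡c′) , _) =
  subst (c ≤_) order≡c′ (c-min ℓ ℓ-proper)

module _ {m j n : ℕ} .{{_ : NonZero n}} {k : ℤ} where

  proper? : ∀ ℓ → Dec (Proper m j ℓ)
  proper? ℓ = ∀-Vtx? λ x → ∀-Vtx? λ y → adj? m j x y →-dec ¬? (ℓ x ≟ℤ ℓ y)

  openColoring? : ∀ ℓ → Dec (OpenColoring m j n k ℓ)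
  openColoring? ℓ = ∀-Vtx? λ x → n ∣? ℤ.∣ nbSum m j ℓ x ℤ.- k ∣

  fromVecs : ∀ {B} → Vec (Fin B) m → Vec (Fin B) m → Labeling m
  fromVecs xs ys (v i) = + toℕ (Vec.lookup xs i)
  fromVecs xs ys (u i) = + toℕ (Vec.lookup ys i)

  OpenColorableByVecs : ∀ {B} → ℕ → Vec (Fin B) m → Vec (Fin B) m → Set
  OpenColorableByVecs d xs ys = Proper m j ℓ × OpenColoring m j n k ℓ × order ℓ ≤ d
    where ℓ = fromVecs xs ys

  compress-openColorable : ∀ {d} → OpenColorable≤ m j n k d →
                           ∃₂ (OpenColorableByVecs {length (allV m) ℕ.* n} d)
  compress-openColorable {d} (ℓ , ℓ-proper , ℓ-open , order≤d) =
    xs , ys , ℓ′-proper , ℓ′-open , ℕₚ.≤-trans order≤ order≤d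
    where
    L = map ℓ (allV m)
    ĉ : ℤ → ℕ
    ĉ = compress n L
    ℓ∈L : ∀ x → ℓ x ∈ L
    ℓ∈L x = ∈-map⁺ ℓ (∈-allV x)
    bounded : ∀ x → ĉ (ℓ x) < length (allV m) ℕ.* n
    bounded x = subst (λ l → ĉ (ℓ x) < l ℕ.* n) (Listₚ.length-map ℓ (allV m))
                      (compress-< n L (ℓ∈L x))
    xs ys : Vec (Fin (length (allV m) ℕ.* n)) m
    xs = Vec.tabulate λ i → fromℕ< (bounded (v i))
    ys = Vec.tabulate λ i → fromℕ< (bounded (u i))
    ℓ′ = fromVecs xs ys
    ℓ′≡ĉℓ : ∀ x → ℓ′ x ≡ + ĉ (ℓ x)
    ℓ′≡ĉℓ (v i) = trans (cong (+_ ∘ toℕ) (lookup∘tabulate _ i))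
                        (cong +_ (toℕ-fromℕ< (bounded (v i))))
    ℓ′≡ĉℓ (u i) = trans (cong (+_ ∘ toℕ) (lookup∘tabulate _ i))
                        (cong +_ (toℕ-fromℕ< (bounded (u i))))
    ℓ′-proper : Proper m j ℓ′
    ℓ′-proper x y x~y eq = ℓ-proper x y x~y (compress-injective n L (ℓ∈L x) (ℓ∈L y)
      (ℤₚ.+-injective (trans (sym (ℓ′≡ĉℓ x)) (trans eq (ℓ′≡ĉℓ y)))))
    residue quotient rank : Labeling m
    residue x  = + (ℓ x %ℕ n)
    quotient x = ℓ x /ℕ n
    rank x     = + indexOf (ℓ x) L
    ℓ≡lift : ∀ x → ℓ x ≡ lift n residue quotient x
    ℓ≡lift x = trans (a≡a%ℕn+[a/ℕn]*n (ℓ x) n)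
                     (cong (ℤ._+_ (residue x)) (ℤₚ.*-comm (quotient x) (+ n)))
    ℓ′-open : OpenColoring m j n k ℓ′
    ℓ′-open = openColoring-cong (λ x → trans (sym (compress-as-lift n L (ℓ x))) (sym (ℓ′≡ĉℓ x)))
      (Equivalence.from (lift-open⇔ residue rank)
        (Equivalence.to (lift-open⇔ residue quotient) (openColoring-cong ℓ≡lift ℓ-open)))
    order≤ : order ℓ′ ≤ order ℓ
    order≤ = subst (order ℓ′ ≤_) (ℕₚ.+-identityʳ (order ℓ))
      (order-≤-* (+ 0 ∷ []) (λ _ z → + ĉ z) (λ x → + 0 , here refl , ℓ′≡ĉℓ x))

  openColorable≤? : ∀ d → Dec (OpenColorable≤ m j n k d)
  openColorable≤? d = map′ (λ (xs , ys , c) → fromVecs xs ys , c) compress-openColorable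
    (∃-Vec? m λ xs → ∃-Vec? m λ ys →
      proper? (fromVecs xs ys) ×-dec openColoring? (fromVecs xs ys) ×-dec order (fromVecs xs ys) ℕ.≤? d)

  chiNK-exists : ∀ ℓ → Proper m j ℓ → OpenColoring m j n k ℓ →
                 ∃ λ c → IsChiNK m j n k c × c ≤ order ℓ
  chiNK-exists ℓ ℓ-proper ℓ-open with least openColorable≤? (ℓ , ℓ-proper , ℓ-open , ℕₚ.≤-refl)
  ... | c , (ℓ′ , ℓ′-proper , ℓ′-open , order≤c) , c-min =
    c , ((ℓ′ , ℓ′-proper , ℓ′-open , ℕₚ.≤-antisym order≤c (minimal ℓ′ ℓ′-proper ℓ′-open)) , minimal)
      , minimal ℓ ℓ-proper ℓ-open
    where
    minimal : ∀ ℓ″ → Proper m j ℓ″ → OpenColoring m j n k ℓ″ → c ≤ order ℓ″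
    minimal ℓ″ ℓ″-proper ℓ″-open = c-min (ℓ″ , ℓ″-proper , ℓ″-open , ℕₚ.≤-refl)

-- The generalized Petersen graph G(m,j) for m = suc p

module GeneralizedPetersen (p j : ℕ) (2≤p : 2 ≤ p) (1≤j : 1 ≤ j) (2j<m : 2 ℕ.* j < suc p) where
  open import Data.Integer using (_+_; _-_; _*_; -_)
  open import Data.List.Membership.DecPropositional (_≟ᵥ_ {suc p}) using (_∈?_)

  m : ℕ
  m = suc p

  private
    j<m : j < m
    j<m = ℕₚ.≤-<-trans (ℕₚ.m≤m+n j (j ℕ.+ 0)) 2j<m

    j≤m : j ≤ m
    j≤m = ℕₚ.<⇒≤ j<m

  neighbours : Vtx m → List (Vtx m)
  neighbours (v i) = v (shift i 1) ∷ v (shift i p) ∷ u i ∷ []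
  neighbours (u i) = u (shift i j) ∷ u (shift i (m ℕ.∸ j)) ∷ v i ∷ []

  adj⇒∈neighbours : ∀ x w → Adj m j x w → w ∈ neighbours x
  adj⇒∈neighbours (v i) (v _)  (inj₁ refl) = here refl
  adj⇒∈neighbours (v i) (v i′) (inj₂ e)    = there (here (cong v (shift-flip refl e)))
  adj⇒∈neighbours (v i) (u _)  (inj₁ refl) = there (there (here refl))
  adj⇒∈neighbours (u i) (v _)  (inj₂ refl) = there (there (here refl))
  adj⇒∈neighbours (u i) (u _)  (inj₁ refl) = here refl
  adj⇒∈neighbours (u i) (u i′) (inj₂ e)    = there (here (cong u (shift-flip (ℕₚ.m+[n∸m]≡n j≤m) e)))

  ∈neighbours⇒adj : ∀ x w → w ∈ neighbours x → Adj m j x w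
  ∈neighbours⇒adj (v i) _ (here refl)                 = inj₁ refl
  ∈neighbours⇒adj (v i) _ (there (here refl))         = inj₂ (sym (shift-inverse i (ℕₚ.+-comm p 1)))
  ∈neighbours⇒adj (v i) _ (there (there (here refl))) = inj₁ refl
  ∈neighbours⇒adj (u i) _ (here refl)                 = inj₁ refl
  ∈neighbours⇒adj (u i) _ (there (here refl))         = inj₂ (sym (shift-inverse i (ℕₚ.m∸n+n≡m j≤m)))
  ∈neighbours⇒adj (u i) _ (there (there (here refl))) = inj₂ refl

  neighbours-unique : ∀ x → Unique (neighbours x)
  neighbours-unique (v i) =
    ((λ e → 1≢p (shift-injective i (ℕₚ.m≤n⇒m≤1+n 2≤p) ℕₚ.≤-refl (v-injective e))) ∷ (λ ()) ∷ [])
    ∷ ((λ ()) ∷ []) ∷ [] ∷ []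
    where
    1≢p : 1 ≢ p
    1≢p = ℕₚ.<⇒≢ 2≤p
  neighbours-unique (u i) =
    ((λ e → j≢m∸j (shift-injective i j<m (ℕₚ.∸-monoʳ-< 1≤j j≤m) (u-injective e))) ∷ (λ ()) ∷ [])
    ∷ ((λ ()) ∷ []) ∷ [] ∷ []
    where
    j≢m∸j : j ≢ m ℕ.∸ j
    j≢m∸j j≡m∸j = ℕₚ.<-irrefl (trans (cong (j ℕ.+_) (ℕₚ.+-identityʳ j))
                              (trans (cong (j ℕ.+_) j≡m∸j) (ℕₚ.m+[n∸m]≡n j≤m))) 2j<m

  nbSum-neighbours : ∀ ℓ x → nbSum m j ℓ x ≡ sumℤ ℓ (neighbours x)
  nbSum-neighbours ℓ x = trans
    (sumℤ-cong (indicator-⇔ (adj? m j x) (_∈? neighbours x) ℓ adj⇔∈neighbours) (allV m))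
    (sumℤ-indicator-∈ _≟ᵥ_ ℓ allV-unique (neighbours-unique x) (λ {w} _ → ∈-allV w))
    where
    adj⇔∈neighbours : ∀ w → Adj m j x w ⇔ w ∈ neighbours x
    adj⇔∈neighbours w = mk⇔ (adj⇒∈neighbours x w) (∈neighbours⇒adj x w)

  nbSum-const : ∀ t x → nbSum m j (λ _ → t) x ≡ + 3 * t
  nbSum-const t (v i) = trans (nbSum-neighbours (λ _ → t) (v i)) (sumℤ-const t (neighbours (v i)))
  nbSum-const t (u i) = trans (nbSum-neighbours (λ _ → t) (u i)) (sumℤ-const t (neighbours (u i)))

  sum-nbSum : ∀ ℓ → sumℤ (nbSum m j ℓ) (allV m) ≡ + 3 * sumℤ ℓ (allV m)
  sum-nbSum ℓ = begin
    sumℤ (λ x → sumℤ (indicator (adj? m j x) ℓ) (allV m)) (allV m)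
      ≡⟨ sumℤ-swap (λ x → indicator (adj? m j x) ℓ) (allV m) (allV m) ⟩
    sumℤ (λ w → sumℤ (λ x → indicator (adj? m j x) ℓ w) (allV m)) (allV m)
      ≡⟨ sumℤ-cong (λ w → sumℤ-cong (indicator-transpose w) (allV m)) (allV m) ⟩
    sumℤ (λ w → sumℤ (λ x → ℓ w * indicator (adj? m j w) (λ _ → + 1) x) (allV m)) (allV m)
      ≡⟨ sumℤ-cong (λ w → trans (sumℤ-*ˡ (ℓ w) _ (allV m)) (degree w)) (allV m) ⟩
    sumℤ (λ w → + 3 * ℓ w) (allV m)
      ≡⟨ sumℤ-*ˡ (+ 3) ℓ (allV m) ⟩
    + 3 * sumℤ ℓ (allV m) ∎
    where
    open ≡-Reasoning
    indicator-transpose : ∀ w x → indicator (adj? m j x) ℓ w ≡ ℓ w * indicator (adj? m j w) (λ _ → + 1) x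
    indicator-transpose w x = trans
      (cong (if_then ℓ w else + 0) (does-⇔ (mk⇔ swap swap) (adj? m j x w) (adj? m j w x)))
      (if-as-* (does (adj? m j w x)))
      where
      if-as-* : ∀ b → (if b then ℓ w else + 0) ≡ ℓ w * (if b then + 1 else + 0)
      if-as-* true  = sym (ℤₚ.*-identityʳ (ℓ w))
      if-as-* false = sym (ℤₚ.*-zeroʳ (ℓ w))
    degree : ∀ w → ℓ w * nbSum m j (λ _ → + 1) w ≡ + 3 * ℓ w
    degree w = trans (cong (ℓ w *_) (nbSum-const (+ 1) w)) (ℤₚ.*-comm (ℓ w) (+ 3))

  open-defect-sum : ∀ ℓ k → sumℤ (λ x → nbSum m j ℓ x - k) (allV m) ≡
                            + 3 * sumℤ ℓ (allV m) - + (m ℕ.+ m) * k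
  open-defect-sum ℓ k = begin
    sumℤ (λ x → nbSum m j ℓ x - k) (allV m)
      ≡⟨ sumℤ-distrib-+ (nbSum m j ℓ) (λ _ → - k) (allV m) ⟩
    sumℤ (nbSum m j ℓ) (allV m) + sumℤ (λ _ → - k) (allV m)
      ≡⟨ cong₂ _+_ (sum-nbSum ℓ) (sumℤ-const (- k) (allV m)) ⟩
    + 3 * sumℤ ℓ (allV m) + + length (allV m) * - k
      ≡⟨ cong (λ l → + 3 * sumℤ ℓ (allV m) + + l * - k) (length-allV {m}) ⟩
    + 3 * sumℤ ℓ (allV m) + + (m ℕ.+ m) * - k
      ≡⟨ cong (_+_ (+ 3 * sumℤ ℓ (allV m))) (ℤₚ.neg-distribʳ-* (+ (m ℕ.+ m)) k) ⟨
    + 3 * sumℤ ℓ (allV m) - + (m ℕ.+ m) * k ∎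
    where open ≡-Reasoning

  openColoring⇒3∣km : ∀ {n k ℓ} → 3 ∣ℕ n → OpenColoring m j n k ℓ → 3 ∣ℕ ℤ.∣ k * + m ∣
  openColoring⇒3∣km {n} {k} {ℓ} 3∣n ℓ-open =
    subst (3 ∣ℕ_) (sym (ℤₚ.abs-* k (+ m))) (∣2*⇒∣ (ℤ.∣ k ∣ ℕ.* m) prime-3 (from-no (3 ∣? 2))
      (subst (3 ∣ℕ_) (trans (ℤₚ.abs-* (+ (m ℕ.+ m)) k) (rearrange m ℤ.∣ k ∣))
             (∣⇒∣ᵤ {+ 3} {+ (m ℕ.+ m) * k} 3∣2mk)))
    where
    rearrange : ∀ m a → (m ℕ.+ m) ℕ.* a ≡ 2 ℕ.* (a ℕ.* m)
    rearrange = ℕ-solve-∀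
    Σℓ = sumℤ ℓ (allV m)
    3∣defects : + 3 ∣ˢ + 3 * Σℓ - + (m ℕ.+ m) * k
    3∣defects = subst (+ 3 ∣ˢ_) (open-defect-sum ℓ k) (sumℤ-∣ (allV m) λ x →
      ∣ˢ-trans (∣ᵤ⇒∣ {+ 3} {+ n} 3∣n) (∣ᵤ⇒∣ {+ n} {nbSum m j ℓ x - k} (ℓ-open x)))
    3∣2mk : + 3 ∣ˢ + (m ℕ.+ m) * k
    3∣2mk = subst (+ 3 ∣ˢ_) (ℤₚ.neg-involutive (+ (m ℕ.+ m) * k))
      (∣m⇒∣-m (∣m+n∣m⇒∣n 3∣defects (divides Σℓ (ℤₚ.*-comm (+ 3) Σℓ))))

  gcd∤km⇒¬ChiNKExists : ∀ {n k} → ¬ (+ gcd 3 n ∣ k * + m) → ¬ ChiNKExists m j n k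
  gcd∤km⇒¬ChiNKExists {n} g∤km (ℓ , _ , ℓ-open) =
    g∤km (Equivalence.from (gcd∣⇔ n prime-3) λ 3∣n → openColoring⇒3∣km 3∣n ℓ-open)

  marked : Vtx m → ℕ
  marked x = δ₂ (toℕ (index x) ℕ.% 3)

  one-marked : 3 ∣ℕ m → ¬ 3 ∣ℕ j → ∀ x → sumℤ (λ w → + marked w) (neighbours x) ≡ + 1
  one-marked 3∣m 3∤j (v i) =
    trans (sumℤ-triple (λ w → + marked w) (v (shift i 1)) (v (shift i p)) (u i))
          (cong +_ (δ₂-shift-sum 3∣m (from-no (3 ∣? 1)) refl i))
  one-marked 3∣m 3∤j (u i) =
    trans (sumℤ-triple (λ w → + marked w) (u (shift i j)) (u (shift i (m ℕ.∸ j))) (v i))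
          (cong +_ (δ₂-shift-sum 3∣m 3∤j (ℕₚ.m+[n∸m]≡n j≤m) i))

  module _ (n : ℕ) .{{_ : NonZero n}} {k : ℤ} {c : ℕ} where

    gcd∣k⇒IsChiNK : + gcd 3 n ∣ k → IsChi m j c → IsChiNK m j n k c
    gcd∣k⇒IsChiNK g∣k ((ℓ , ℓ-proper , order≡c) , c-min) with linear-congruence 3 n g∣k
    ... | t , n∣3t-k =
      (ℓ₁ , ℓ₁-proper , ℓ₁-open , ℕₚ.≤-antisym order≤c (c-min ℓ₁ ℓ₁-proper)) ,
      λ ℓ′ ℓ′-proper _ → c-min ℓ′ ℓ′-proper
      where
      ℓ₁ : Labeling m
      ℓ₁ = lift n (λ _ → t) ℓ
      ℓ₁-proper : Proper m j ℓ₁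
      ℓ₁-proper = lift-proper n (λ _ → t) ℓ (λ _ _ _ → refl) ℓ-proper
      ℓ₁-open : OpenColoring m j n k ℓ₁
      ℓ₁-open = Equivalence.from (lift-open⇔ (λ _ → t) ℓ)
        λ x → subst (λ s → + n ∣ s - k) (sym (nbSum-const t x)) n∣3t-k
      order≤c : order ℓ₁ ≤ c
      order≤c = subst (order ℓ₁ ≤_) (trans (ℕₚ.+-identityʳ _) order≡c)
        (order-≤-* (t ∷ []) (λ r z → r + + n * z) {ℓ} {ℓ₁} (λ x → t , here refl , refl))

    marker : Labeling m
    marker x = k * + marked x

    marker-0∨k : ∀ x → marker x ≡ + 0 ⊎ marker x ≡ k
    marker-0∨k x with marked x | δ₂-0∨1 (toℕ (index x) ℕ.% 3)
    ... | _ | inj₁ refl = inj₁ (ℤₚ.*-zeroʳ k)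
    ... | _ | inj₂ refl = inj₂ (ℤₚ.*-identityʳ k)

    marker-separated : ¬ (+ n ∣ k) → ∀ x y → + n ∣ marker x - marker y → marker x ≡ marker y
    marker-separated n∤k x y = separated (marker-0∨k x) (marker-0∨k y)
      where
      separated : ∀ {r s} → r ≡ + 0 ⊎ r ≡ k → s ≡ + 0 ⊎ s ≡ k → + n ∣ r - s → r ≡ s
      separated (inj₁ refl) (inj₁ refl) _ = refl
      separated (inj₂ refl) (inj₂ refl) _ = refl
      separated (inj₁ refl) (inj₂ refl) n∣-k = ⊥-elim (n∤k
        (subst (n ∣ℕ_) (trans (cong ℤ.∣_∣ (ℤₚ.+-identityˡ (- k))) (ℤₚ.∣-i∣≡∣i∣ k)) n∣-k))
      separated (inj₂ refl) (inj₁ refl) n∣k =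
        ⊥-elim (n∤k (subst (n ∣ℕ_) (cong ℤ.∣_∣ (ℤₚ.+-identityʳ k)) n∣k))

    marker-nbSum : 3 ∣ℕ m → ¬ 3 ∣ℕ j → ∀ x → nbSum m j marker x ≡ k
    marker-nbSum 3∣m 3∤j x = begin
      nbSum m j marker x                        ≡⟨ nbSum-neighbours marker x ⟩
      sumℤ marker (neighbours x)                ≡⟨ sumℤ-*ˡ k _ (neighbours x) ⟩
      k * sumℤ (λ w → + marked w) (neighbours x) ≡⟨ cong (k *_) (one-marked 3∣m 3∤j x) ⟩
      k * + 1                                   ≡⟨ ℤₚ.*-identityʳ k ⟩
      k                                         ∎
      where open ≡-Reasoning

    marker-lift : ¬ (+ n ∣ k) → 3 ∣ℕ m → ¬ 3 ∣ℕ j → ∀ ℓ → Proper m j ℓ →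
                  Proper m j (lift n marker ℓ) × OpenColoring m j n k (lift n marker ℓ) ×
                  order (lift n marker ℓ) ≤ 2 ℕ.* order ℓ
    marker-lift n∤k 3∣m 3∤j ℓ ℓ-proper =
      lift-proper n marker ℓ (marker-separated n∤k) ℓ-proper ,
      Equivalence.from (lift-open⇔ marker ℓ)
        (λ x → subst (λ s → + n ∣ s - k) (sym (marker-nbSum 3∣m 3∤j x)) n∣k-k) ,
      order-≤-* (+ 0 ∷ k ∷ []) (λ r z → r + + n * z) {ℓ} {lift n marker ℓ} λ x →
        [ (λ marker≡0 → + 0 , here refl , cong (_+ + n * ℓ x) marker≡0) ,
          (λ marker≡k → k , there (here refl) , cong (_+ + n * ℓ x) marker≡k) ]′ (marker-0∨k x)
      where
      n∣k-k : + n ∣ k - k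
      n∣k-k = subst (n ∣ℕ_) (cong ℤ.∣_∣ (sym (ℤₚ.+-inverseʳ k))) (n ∣0)

    chi≤chiNK≤2chi : ¬ (+ n ∣ k) → 3 ∣ℕ m → ¬ 3 ∣ℕ j → IsChi m j c →
                     ChiNKExists m j n k × Σ ℕ λ c′ → IsChiNK m j n k c′ × c ≤ c′ × c′ ≤ 2 ℕ.* c
    chi≤chiNK≤2chi n∤k 3∣m 3∤j χ@((ℓ , ℓ-proper , order≡c) , _) =
      let ℓ₃-proper , ℓ₃-open , order₃≤2order = marker-lift n∤k 3∣m 3∤j ℓ ℓ-proper
          c′ , χ≡c′ , c′≤order₃ = chiNK-exists (lift n marker ℓ) ℓ₃-proper ℓ₃-open
      in (lift n marker ℓ , ℓ₃-proper , ℓ₃-open) , c′ , χ≡c′ , chi≤chiNK χ χ≡c′ ,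
         ℕₚ.≤-trans c′≤order₃
                    (subst (λ o → order (lift n marker ℓ) ≤ 2 ℕ.* o) order≡c order₃≤2order)

open import Data.Nat using (_*_)

theorem6p13 : (k : ℤ) (n m j : ℕ) →
  2 ≤ n → ¬ ((+ n) ∣ k) → 3 ≤ m → 1 ≤ j → 2 * j < m →
  (c : ℕ) → IsChi m j c →
    ((+ gcd 3 n) ∣ k → IsChiNK m j n k c)
    × (¬ ((+ gcd 3 n) ∣ (k ℤ.* (+ m))) → ¬ ChiNKExists m j n k)
    × (¬ ((+ gcd 3 n) ∣ k) → (+ gcd 3 n) ∣ (k ℤ.* (+ m)) → ¬ (3 ∣ℕ j) →
        ChiNKExists m j n k × Σ ℕ λ c' → IsChiNK m j n k c' × c ≤ c' × c' ≤ 2 * c)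
theorem6p13 k n@(suc _) m@(suc p) j _ n∤k 3≤m 1≤j 2j<m c χ =
    (λ g∣k → gcd∣k⇒IsChiNK n g∣k χ)
  , gcd∤km⇒¬ChiNKExists
  , λ g∤k g∣km 3∤j → chi≤chiNK≤2chi n n∤k (3∣m g∤k g∣km) 3∤j χ
  where
  open GeneralizedPetersen p j (ℕ.s≤s⁻¹ 3≤m) 1≤j 2j<m
    using (gcd∣k⇒IsChiNK; gcd∤km⇒¬ChiNKExists; chi≤chiNK≤2chi)
  3∣m : ¬ (+ gcd 3 n ∣ k) → + gcd 3 n ∣ k ℤ.* + m → 3 ∣ℕ m
  3∣m g∤k g∣km =
    gcd∤a∧gcd∣ab⇒∣b n prime-3 g∤k (subst (gcd 3 n ∣ℕ_) (ℤₚ.abs-* k (+ m)) g∣km)
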